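{- Let $m$ be a positive integer. The linear program \[ \max \sum_{k=1}^m\varphi(k)x_k \quad\text{subject to}\quad x_k+x_\ell\leq\frac{2}{k\ell}\ (k,\ell=1,\dots,m),\quad x\geq 0,\ x\in\mathbb{R}^m, \] has an optimal value, and this optimal value is at most $\sum_{k=1}^m\frac{\varphi(k)}{k^2}$.
   Context: $\varphi$ denotes Euler's totient function.
   Formalization: The vector $x$ ranges over ℚ^m instead of ℝ^m, both for the optimal point and for the feasible points it is compared with. -}

module Defs where

open import Data.Nat as ℕ using (ℕ; suc; _≟_)
open import Data.Nat.GCD using (gcd)
open import Data.List using (List; length; filter; map; upTo)
open import Data.Fin using (Fin; toℕ; zero; suc)
open import Data.Integer using (+_)
open import Data.Rational using (ℚ; 0ℚ; _+_; _*_; _≤_; _/_)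
open import Data.Product using (_×_)
open import Relation.Nullary.Decidable using (Dec)

totient : ℕ → ℕ
totient n = length (filter (λ k → gcd k n ≟ 1) (map suc (upTo n)))

-- the index i : Fin m stands for k = i + 1 ∈ {1,…,m}
idx : ∀ {m} → Fin m → ℕ
idx i = suc (toℕ i)

sumFin : ∀ {m} → (Fin m → ℚ) → ℚ
sumFin {ℕ.zero} f = 0ℚ
sumFin {suc m} f = f zero + sumFin (λ i → f (suc i))

Feasible : ∀ m → (Fin m → ℚ) → Set
Feasible m x = (∀ i → 0ℚ ≤ x i)
             × (∀ i j → x i + x j ≤ (+ 2) / (idx i ℕ.* idx j))

objective : ∀ m → (Fin m → ℚ) → ℚ
objective m x = sumFin (λ i → ((+ totient (idx i)) / 1) * x i)

bound : ℕ → ℚ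
bound m = sumFin {m} (λ i → (+ totient (idx i)) / (idx i ℕ.* idx i))

{-# OPTIONS --safe #-}
module Submission where

-- Taking k = ℓ in the constraints gives x_k ≤ 1/k², so on the feasible polytope, which contains 0,
-- the objective is at most ∑ φ(k)/k². A feasible linear program over ℚ that is bounded above
-- attains its supremum, which we prove constructively by Fourier–Motzkin elimination: eliminating x
-- from the hypograph {(t, x) : t ≤ c·x, x feasible} leaves finitely many lower and upper bounds on
-- t; the least upper bound (capped by the a priori bound) is admissible, and back substitution
-- recovers x.

module FourierMotzkin where

  open import Data.Nat using (ℕ; zero; suc)
  open import Data.Fin using (Fin; zero; suc)
  open import Data.Rational
    using (ℚ; 0ℚ; 1ℚ; _+_; _-_; -_; _*_; _≤_; _<_; 1/_; positive; ≢-nonZero)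
  open import Data.Rational.Properties
  open import Data.Rational.Solver using (module +-*-Solver)
  open import Data.Vec.Functional using (Vector; head; tail; map; zipWith) renaming (_∷_ to _∷ᵥ_)
  open import Data.List as List using (List; []; _∷_; _++_; cartesianProductWith)
  open import Data.List.Relation.Unary.All as All using (All; []; _∷_)
  import Data.List.Relation.Unary.All.Properties as All
  import Data.List.Extrema
  open import Data.Product using (Σ-syntax; _×_; _,_; proj₁)
  open import Data.Sum using (inj₁)
  open import Function using (_⇔_; mk⇔; Equivalence)
  open import Function.Properties.Equivalence using () renaming (refl to ⇔-refl; trans to ⇔-trans)
  open import Relation.Binary using (DecTotalOrder)
  open import Relation.Binary.Definitions using (tri<; tri≈; tri>)
  open import Relation.Binary.PropositionalEquality
  open import Defs using (sumFin)

  open +-*-Solver using (solve; con; _:+_; _:-_; _:*_; :-_; _:=_)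
  open Equivalence using (to; from)
  open Data.List.Extrema (DecTotalOrder.totalOrder ≤-decTotalOrder)
    using (min; max; min≤xs; xs≤max; v≤min⁺; v≤max⁺)

  private
    variable
      n : ℕ

  infixl 8 _∙_

  _∙_ : Vector ℚ n → Vector ℚ n → ℚ
  a ∙ x = sumFin (λ i → a i * x i)

  ∙-zeroˡ : (x : Vector ℚ n) → (λ _ → 0ℚ) ∙ x ≡ 0ℚ
  ∙-zeroˡ {zero}  x = refl
  ∙-zeroˡ {suc n} x =
    trans (cong (0ℚ * head x +_) (∙-zeroˡ (tail x))) (trans (+-identityʳ _) (*-zeroˡ (head x)))

  ∙-sub : (a b x : Vector ℚ n) → zipWith _-_ a b ∙ x ≡ a ∙ x - b ∙ x
  ∙-sub {zero}  a b x = refl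
  ∙-sub {suc n} a b x =
    trans (cong ((head a - head b) * head x +_) (∙-sub (tail a) (tail b) (tail x)))
          (solve 5 (λ a b t d e → (a :- b) :* t :+ (d :- e) := (a :* t :+ d) :- (b :* t :+ e))
                 refl (head a) (head b) (head x) (tail a ∙ tail x) (tail b ∙ tail x))

  ∙-scale : ∀ r (a x : Vector ℚ n) → map (r *_) a ∙ x ≡ r * (a ∙ x)
  ∙-scale {zero}  r a x = sym (*-zeroʳ r)
  ∙-scale {suc n} r a x =
    trans (cong (r * head a * head x +_) (∙-scale r (tail a) (tail x)))
          (solve 4 (λ r a t d → r :* a :* t :+ r :* d := r :* (a :* t :+ d))
                 refl r (head a) (head x) (tail a ∙ tail x))

  record Affine (n : ℕ) : Set where
    constructor affine
    field
      constant : ℚ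
      linear   : Vector ℚ n

  open Affine

  ⟦_⟧ : Affine n → Vector ℚ n → ℚ
  ⟦ f ⟧ x = constant f + linear f ∙ x

  infixl 6 _⊖_
  infixr 7 _⊛_

  _⊖_ : Affine n → Affine n → Affine n
  f ⊖ g = affine (constant f - constant g) (zipWith _-_ (linear f) (linear g))

  _⊛_ : ℚ → Affine n → Affine n
  r ⊛ f = affine (r * constant f) (map (r *_) (linear f))

  ⟦⊖⟧ : ∀ f g (x : Vector ℚ n) → ⟦ f ⊖ g ⟧ x ≡ ⟦ f ⟧ x - ⟦ g ⟧ x
  ⟦⊖⟧ f g x =
    trans (cong (constant f - constant g +_) (∙-sub (linear f) (linear g) x))
          (solve 4 (λ c d u v → (c :- d) :+ (u :- v) := (c :+ u) :- (d :+ v))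
                 refl (constant f) (constant g) (linear f ∙ x) (linear g ∙ x))

  ⟦⊛⟧ : ∀ r f (x : Vector ℚ n) → ⟦ r ⊛ f ⟧ x ≡ r * ⟦ f ⟧ x
  ⟦⊛⟧ r f x =
    trans (cong (r * constant f +_) (∙-scale r (linear f) x))
          (sym (*-distribˡ-+ r (constant f) (linear f ∙ x)))

  unit : Fin n → Vector ℚ n
  unit zero    = 1ℚ ∷ᵥ λ _ → 0ℚ
  unit (suc i) = 0ℚ ∷ᵥ unit i

  ∙-unit : ∀ i (x : Vector ℚ n) → unit i ∙ x ≡ x i
  ∙-unit zero    x =
    trans (cong (1ℚ * head x +_) (∙-zeroˡ (tail x))) (trans (+-identityʳ _) (*-identityˡ _))
  ∙-unit (suc i) x =
    trans (cong (0ℚ * head x +_) (∙-unit i (tail x)))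
          (trans (cong (_+ x (suc i)) (*-zeroˡ (head x))) (+-identityˡ _))

  coordinate : Fin n → Affine n
  coordinate i = affine 0ℚ (unit i)

  constantAffine : ℚ → Affine n
  constantAffine c = affine c λ _ → 0ℚ

  ⟦coordinate⟧ : ∀ i (x : Vector ℚ n) → ⟦ coordinate i ⟧ x ≡ x i
  ⟦coordinate⟧ i x = trans (+-identityˡ _) (∙-unit i x)

  ⟦constantAffine⟧ : ∀ c (x : Vector ℚ n) → ⟦ constantAffine c ⟧ x ≡ c
  ⟦constantAffine⟧ c x = trans (cong (c +_) (∙-zeroˡ x)) (+-identityʳ c)

  infix 4 _⊨_ _⊨*_

  _⊨_ : Vector ℚ n → Affine n → Set
  x ⊨ f = 0ℚ ≤ ⟦ f ⟧ x

  System : ℕ → Set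
  System n = List (Affine n)

  _⊨*_ : Vector ℚ n → System n → Set
  x ⊨* S = All (x ⊨_) S

  Maximiser : (Vector ℚ n → ℚ) → System n → Set
  Maximiser {n} g S = Σ[ p ∈ Vector ℚ n ] p ⊨* S × (∀ q → q ⊨* S → g q ≤ g p)

  0≤q-p⇔p≤q : ∀ {p q} → 0ℚ ≤ q - p ⇔ p ≤ q
  0≤q-p⇔p≤q {p} {q} = mk⇔
    (λ h → subst₂ _≤_ (+-identityˡ p) (solve 2 (λ p q → q :- p :+ p := q) refl p q)
                      (+-monoˡ-≤ p h))
    (λ h → subst (_≤ q - p) (+-inverseʳ p) (+-monoˡ-≤ (- p) h))

  0≤c*u⇔0≤u : ∀ {c u} → 0ℚ < c → 0ℚ ≤ c * u ⇔ 0ℚ ≤ u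
  0≤c*u⇔0≤u {c} {u} 0<c = mk⇔
    (λ h → *-cancelˡ-≤-pos c (subst (_≤ c * u) (sym (*-zeroʳ c)) h))
    (λ h → subst (_≤ c * u) (*-zeroʳ c) (*-monoˡ-≤-nonNeg c {{pos⇒nonNeg c}} h))
    where instance _ = positive 0<c

  ≡⇒⇔ : ∀ {A B : Set} → A ≡ B → A ⇔ B
  ≡⇒⇔ refl = ⇔-refl

  insert-inverse : ∀ {a a⁻¹} → a * a⁻¹ ≡ 1ℚ → ∀ t r → a * t + r ≡ a * t + a * a⁻¹ * r
  insert-inverse {a} inv t r = cong (a * t +_) (trans (sym (*-identityˡ r)) (cong (_* r) (sym inv)))

  0≤a*t+r⇔-a⁻¹*r≤t : ∀ {a a⁻¹} → 0ℚ < a → a * a⁻¹ ≡ 1ℚ → ∀ t r → 0ℚ ≤ a * t + r ⇔ - a⁻¹ * r ≤ t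
  0≤a*t+r⇔-a⁻¹*r≤t {a} {a⁻¹} 0<a inv t r =
    ⇔-trans (≡⇒⇔ (cong (0ℚ ≤_) factor)) (⇔-trans (0≤c*u⇔0≤u 0<a) 0≤q-p⇔p≤q)
    where
      factor : a * t + r ≡ a * (t - - a⁻¹ * r)
      factor = trans (insert-inverse {a} {a⁻¹} inv t r)
        (solve 4 (λ a b t r → a :* t :+ a :* b :* r := a :* (t :- :- b :* r)) refl a a⁻¹ t r)

  0≤a*t+r⇔t≤-a⁻¹*r : ∀ {a a⁻¹} → a < 0ℚ → a * a⁻¹ ≡ 1ℚ → ∀ t r → 0ℚ ≤ a * t + r ⇔ t ≤ - a⁻¹ * r
  0≤a*t+r⇔t≤-a⁻¹*r {a} {a⁻¹} a<0 inv t r =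
    ⇔-trans (≡⇒⇔ (cong (0ℚ ≤_) factor)) (⇔-trans (0≤c*u⇔0≤u (neg-antimono-< a<0)) 0≤q-p⇔p≤q)
    where
      factor : a * t + r ≡ - a * (- a⁻¹ * r - t)
      factor = trans (insert-inverse {a} {a⁻¹} inv t r)
        (solve 4 (λ a b t r → a :* t :+ a :* b :* r := :- a :* (:- b :* r :- t)) refl a a⁻¹ t r)

  reciprocal : ∀ {a} → 0ℚ ≢ a → Σ[ a⁻¹ ∈ ℚ ] a * a⁻¹ ≡ 1ℚ
  reciprocal {a} 0≢a = 1/ a , *-inverseʳ a
    where instance _ = ≢-nonZero (≢-sym 0≢a)

  lead : Affine (suc n) → ℚ
  lead f = head (linear f)

  rest : Affine (suc n) → Affine n
  rest f = affine (constant f) (tail (linear f))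

  root : Affine (suc n) → ℚ → Affine n
  root f a⁻¹ = - a⁻¹ ⊛ rest f

  ⊨-∷⇔ : ∀ f t (x : Vector ℚ n) → (t ∷ᵥ x) ⊨ f ⇔ 0ℚ ≤ lead f * t + ⟦ rest f ⟧ x
  ⊨-∷⇔ f t x = ≡⇒⇔ (cong (0ℚ ≤_) (solve 3 (λ c u d → c :+ (u :+ d) := u :+ (c :+ d))
                                           refl (constant f) (lead f * t) (tail (linear f) ∙ x)))

  data Role (n : ℕ) : Set where
    free upper lower : Affine n → Role n

  role : Affine (suc n) → Role n
  role f with <-cmp 0ℚ (lead f)
  ... | tri< _ 0≢a _ = lower (root f (proj₁ (reciprocal 0≢a)))
  ... | tri≈ _ _ _   = free (rest f)
  ... | tri> _ 0≢a _ = upper (root f (proj₁ (reciprocal 0≢a)))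

  Admits : ℚ → Vector ℚ n → Role n → Set
  Admits t x (free f)  = x ⊨ f
  Admits t x (upper f) = t ≤ ⟦ f ⟧ x
  Admits t x (lower f) = ⟦ f ⟧ x ≤ t

  role-correct : ∀ {f t} {x : Vector ℚ n} → (t ∷ᵥ x) ⊨ f ⇔ Admits t x (role f)
  role-correct {f = f} {t} {x} with <-cmp 0ℚ (lead f)
  ... | tri< 0<a 0≢a _ = let a⁻¹ , inv = reciprocal 0≢a in
    ⇔-trans (⊨-∷⇔ f t x) (⇔-trans (0≤a*t+r⇔-a⁻¹*r≤t 0<a inv t _)
                                   (≡⇒⇔ (cong (_≤ t) (sym (⟦⊛⟧ (- a⁻¹) (rest f) x)))))
  ... | tri> _ 0≢a a<0 = let a⁻¹ , inv = reciprocal 0≢a in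
    ⇔-trans (⊨-∷⇔ f t x) (⇔-trans (0≤a*t+r⇔t≤-a⁻¹*r a<0 inv t _)
                                   (≡⇒⇔ (cong (t ≤_) (sym (⟦⊛⟧ (- a⁻¹) (rest f) x)))))
  ... | tri≈ _ 0≡a _ = ⇔-trans (⊨-∷⇔ f t x) (≡⇒⇔ (cong (0ℚ ≤_) vanish))
    where
      vanish : lead f * t + ⟦ rest f ⟧ x ≡ ⟦ rest f ⟧ x
      vanish rewrite sym 0≡a = trans (cong (_+ _) (*-zeroˡ t)) (+-identityˡ _)

  clamp : ℚ → List ℚ → List ℚ → ℚ
  clamp b ls us = min (max b ls) us

  clamp≤us : ∀ b ls us → All (clamp b ls us ≤_) us
  clamp≤us b ls = min≤xs (max b ls)

  ls≤clamp : ∀ b ls us → All (λ l → All (l ≤_) us) ls → All (_≤ clamp b ls us) ls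
  ls≤clamp b ls us l≤us = All.zipWith (λ (l≤max , l≤u) → v≤min⁺ l≤max l≤u) (xs≤max b ls , l≤us)

  clamp-maximal : ∀ {s} b ls us → s ≤ b → All (s ≤_) us → s ≤ clamp b ls us
  clamp-maximal b ls us s≤b s≤us = v≤min⁺ (v≤max⁺ b ls (inj₁ s≤b)) s≤us

  frees uppers lowers : List (Role n) → System n
  frees []             = []
  frees (free f ∷ R)   = f ∷ frees R
  frees (upper _ ∷ R)  = frees R
  frees (lower _ ∷ R)  = frees R
  uppers []            = []
  uppers (free _ ∷ R)  = uppers R
  uppers (upper f ∷ R) = f ∷ uppers R
  uppers (lower _ ∷ R) = uppers R
  lowers []            = []
  lowers (free _ ∷ R)  = lowers R
  lowers (upper _ ∷ R) = lowers R
  lowers (lower f ∷ R) = f ∷ lowers R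

  record Fits (t : ℚ) (x : Vector ℚ n) (R : List (Role n)) : Set where
    constructor fits
    field
      frees-hold   : x ⊨* frees R
      below-uppers : All (λ u → t ≤ ⟦ u ⟧ x) (uppers R)
      above-lowers : All (λ l → ⟦ l ⟧ x ≤ t) (lowers R)

  all-admits⇒fits : ∀ {t} {x : Vector ℚ n} R → All (Admits t x) R → Fits t x R
  all-admits⇒fits []            []       = fits [] [] []
  all-admits⇒fits (free _ ∷ R)  (h ∷ hs) = let fits a b c = all-admits⇒fits R hs in fits (h ∷ a) b c
  all-admits⇒fits (upper _ ∷ R) (h ∷ hs) = let fits a b c = all-admits⇒fits R hs in fits a (h ∷ b) c
  all-admits⇒fits (lower _ ∷ R) (h ∷ hs) = let fits a b c = all-admits⇒fits R hs in fits a b (h ∷ c)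

  fits⇒all-admits : ∀ {t} {x : Vector ℚ n} R → Fits t x R → All (Admits t x) R
  fits⇒all-admits []            _                 = []
  fits⇒all-admits (free _ ∷ R)  (fits (h ∷ a) b c) = h ∷ fits⇒all-admits R (fits a b c)
  fits⇒all-admits (upper _ ∷ R) (fits a (h ∷ b) c) = h ∷ fits⇒all-admits R (fits a b c)
  fits⇒all-admits (lower _ ∷ R) (fits a b (h ∷ c)) = h ∷ fits⇒all-admits R (fits a b c)

  roles : System (suc n) → List (Role n)
  roles = List.map role

  ⊨*⇒fits : ∀ S {t} {x : Vector ℚ n} → (t ∷ᵥ x) ⊨* S → Fits t x (roles S)
  ⊨*⇒fits S h = all-admits⇒fits (roles S) (All.map⁺ (All.map (to role-correct) h))

  fits⇒⊨* : ∀ S {t} {x : Vector ℚ n} → Fits t x (roles S) → (t ∷ᵥ x) ⊨* S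
  fits⇒⊨* S F = All.map (from role-correct) (All.map⁻ (fits⇒all-admits (roles S) F))

  module _ {A B C : Set} {P : C → Set} {f : A → B → C} where

    All-cartesianProductWith⁺ : ∀ xs ys → All (λ a → All (λ b → P (f a b)) ys) xs →
                                All P (cartesianProductWith f xs ys)
    All-cartesianProductWith⁺ []       ys []       = []
    All-cartesianProductWith⁺ (a ∷ xs) ys (h ∷ hs) =
      All.++⁺ (All.map⁺ h) (All-cartesianProductWith⁺ xs ys hs)

    All-cartesianProductWith⁻ : ∀ xs ys → All P (cartesianProductWith f xs ys) →
                                All (λ a → All (λ b → P (f a b)) ys) xs
    All-cartesianProductWith⁻ []       ys h = []
    All-cartesianProductWith⁻ (a ∷ xs) ys h =
      All.map⁻ (All.++⁻ˡ (List.map (f a) ys) h)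
      ∷ All-cartesianProductWith⁻ xs ys (All.++⁻ʳ (List.map (f a) ys) h)

  ⊨⊖⇔ : ∀ u l {x : Vector ℚ n} → x ⊨ u ⊖ l ⇔ ⟦ l ⟧ x ≤ ⟦ u ⟧ x
  ⊨⊖⇔ u l {x} = ⇔-trans (≡⇒⇔ (cong (0ℚ ≤_) (⟦⊖⟧ u l x))) 0≤q-p⇔p≤q

  elim : System (suc n) → System n
  elim S = frees R ++ cartesianProductWith (λ l u → u ⊖ l) (lowers R) (uppers R)
    where R = roles S

  elim-sound : ∀ S t (x : Vector ℚ n) → (t ∷ᵥ x) ⊨* S → x ⊨* elim S
  elim-sound S t x h = All.++⁺ frees-hold (All-cartesianProductWith⁺ _ _
      (All.map (λ {l} l≤t → All.map (λ {u} t≤u → from (⊨⊖⇔ u l) (≤-trans l≤t t≤u)) below-uppers)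
               above-lowers))
    where open Fits (⊨*⇒fits S h)

  values : System n → Vector ℚ n → List ℚ
  values S x = List.map (λ f → ⟦ f ⟧ x) S

  extension : ℚ → System (suc n) → Vector ℚ n → ℚ
  extension b S x = clamp b (values (lowers (roles S)) x) (values (uppers (roles S)) x)

  extension-sound : ∀ b S (x : Vector ℚ n) → x ⊨* elim S → (extension b S x ∷ᵥ x) ⊨* S
  extension-sound b S x h = fits⇒⊨* S (fits
      (All.++⁻ˡ (frees R) h)
      (All.map⁻ (clamp≤us b ls us))
      (All.map⁻ (ls≤clamp b ls us gaps)))
    where
      R  = roles S
      ls = values (lowers R) x
      us = values (uppers R) x
      gaps : All (λ l → All (l ≤_) us) ls
      gaps = All.map⁺ (All.map (λ {l} h → All.map⁺ (All.map (λ {u} → to (⊨⊖⇔ u l)) h))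
               (All-cartesianProductWith⁻ (lowers R) (uppers R) (All.++⁻ʳ (frees R) h)))

  extension-maximal : ∀ b S t (x : Vector ℚ n) → (t ∷ᵥ x) ⊨* S → t ≤ b → t ≤ extension b S x
  extension-maximal b S t x h t≤b = clamp-maximal b (values (lowers (roles S)) x) _ t≤b
    (All.map⁺ (Fits.below-uppers (⊨*⇒fits S h)))

  elim-complete : ∀ S (x : Vector ℚ n) → x ⊨* elim S → Σ[ t ∈ ℚ ] (t ∷ᵥ x) ⊨* S
  elim-complete S x h = extension 0ℚ S x , extension-sound 0ℚ S x h

  swap : Affine (suc (suc n)) → Affine (suc (suc n))
  swap f = affine (constant f) (linear f (suc zero) ∷ᵥ linear f zero ∷ᵥ tail (tail (linear f)))

  ⊨*-swap⇔ : ∀ S {s t} {x : Vector ℚ n} → (s ∷ᵥ t ∷ᵥ x) ⊨* List.map swap S ⇔ (t ∷ᵥ s ∷ᵥ x) ⊨* S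
  ⊨*-swap⇔ S {s} {t} {x} = mk⇔
    (λ h → All.map (λ {f} → subst (0ℚ ≤_) (⟦swap⟧ f)) (All.map⁻ h))
    (λ h → All.map⁺ (All.map (λ {f} → subst (0ℚ ≤_) (sym (⟦swap⟧ f))) h))
    where
      ⟦swap⟧ : ∀ f → ⟦ swap f ⟧ (s ∷ᵥ t ∷ᵥ x) ≡ ⟦ f ⟧ (t ∷ᵥ s ∷ᵥ x)
      ⟦swap⟧ f =
        solve 6 (λ c a b s t d → c :+ (b :* s :+ (a :* t :+ d)) := c :+ (a :* t :+ (b :* s :+ d)))
                refl (constant f) (linear f zero) (linear f (suc zero)) s t
                (tail (tail (linear f)) ∙ x)

  maximise-head : ∀ (S : System (suc n)) p₀ → p₀ ⊨* S →
                  ∀ B → (∀ p → p ⊨* S → head p ≤ B) → Maximiser head S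
  -- In the maximality clause h is used at head p ∷ᵥ tail p₀: a vector of length 0 does not
  -- contribute to ⟦_⟧.
  maximise-head {zero} S p₀ h₀ B bounded =
      extension B S (tail p₀) ∷ᵥ tail p₀
    , extension-sound B S (tail p₀) (elim-sound S (head p₀) (tail p₀) h₀)
    , λ p h → extension-maximal B S (head p) (tail p₀) h (bounded p h)
  maximise-head {suc n} S p₀ h₀ B bounded =
    let p , h , maximal = maximise-head T (skip₁ p₀) (project p₀ h₀) B
                            (λ p h → let s , h′ = lift p h in bounded (insert₁ p s) h′)
        s , h′ = lift p h
    in insert₁ p s , h′ , λ q hq → maximal (skip₁ q) (project q hq)
    where
      T = elim (List.map swap S)
      skip₁ : Vector ℚ (suc (suc n)) → Vector ℚ (suc n)
      skip₁ q = head q ∷ᵥ tail (tail q)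
      insert₁ : Vector ℚ (suc n) → ℚ → Vector ℚ (suc (suc n))
      insert₁ p s = head p ∷ᵥ s ∷ᵥ tail p
      project : ∀ q → q ⊨* S → skip₁ q ⊨* T
      project q h = elim-sound (List.map swap S) (q (suc zero)) (skip₁ q) (from (⊨*-swap⇔ S) h)
      lift : ∀ p → p ⊨* T → Σ[ s ∈ ℚ ] insert₁ p s ⊨* S
      lift p h = let s , h′ = elim-complete (List.map swap S) p h in s , to (⊨*-swap⇔ S) h′

  weaken : Affine n → Affine (suc n)
  weaken f = affine (constant f) (0ℚ ∷ᵥ linear f)

  hypograph : Vector ℚ n → System n → System (suc n)
  hypograph c S = affine 0ℚ (- 1ℚ ∷ᵥ c) ∷ List.map weaken S

  ⊨*-hypograph⇔ : ∀ c S t (x : Vector ℚ n) → (t ∷ᵥ x) ⊨* hypograph c S ⇔ (t ≤ c ∙ x × x ⊨* S)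
  ⊨*-hypograph⇔ c S t x = mk⇔
    (λ { (h ∷ hs) → to 0≤q-p⇔p≤q (subst (0ℚ ≤_) ⟦top⟧ h)
                  , All.map (λ {f} → subst (0ℚ ≤_) (⟦weaken⟧ f)) (All.map⁻ hs) })
    (λ (t≤c∙x , hs) → subst (0ℚ ≤_) (sym ⟦top⟧) (from 0≤q-p⇔p≤q t≤c∙x)
                      ∷ All.map⁺ (All.map (λ {f} → subst (0ℚ ≤_) (sym (⟦weaken⟧ f))) hs))
    where
      ⟦top⟧ : ⟦ affine 0ℚ (- 1ℚ ∷ᵥ c) ⟧ (t ∷ᵥ x) ≡ c ∙ x - t
      ⟦top⟧ = solve 2 (λ t d → con 0ℚ :+ (:- con 1ℚ :* t :+ d) := d :- t) refl t (c ∙ x)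
      ⟦weaken⟧ : ∀ f → ⟦ weaken f ⟧ (t ∷ᵥ x) ≡ ⟦ f ⟧ x
      ⟦weaken⟧ f = cong (constant f +_) (trans (cong (_+ linear f ∙ x) (*-zeroˡ t)) (+-identityˡ _))

  maximise : ∀ (c : Vector ℚ n) S x₀ → x₀ ⊨* S →
             ∀ B → (∀ x → x ⊨* S → c ∙ x ≤ B) → Maximiser (c ∙_) S
  maximise c S x₀ h₀ B bounded =
    let p , h , maximal = maximise-head (hypograph c S) (c ∙ x₀ ∷ᵥ x₀) (on-graph x₀ h₀) B below-B
        t≤c∙x , feasible = to (hyp (head p) (tail p)) h
    in tail p , feasible , λ x hx → ≤-trans (maximal (c ∙ x ∷ᵥ x) (on-graph x hx)) t≤c∙x
    where
      hyp = ⊨*-hypograph⇔ c S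
      on-graph : ∀ x → x ⊨* S → (c ∙ x ∷ᵥ x) ⊨* hypograph c S
      on-graph x hx = from (hyp (c ∙ x) x) (≤-refl , hx)
      below-B : ∀ p → p ⊨* hypograph c S → head p ≤ B
      below-B p h = let t≤c∙x , hx = to (hyp (head p) (tail p)) h in
                    ≤-trans t≤c∙x (bounded (tail p) hx)

module TotientProgram where

  open import Data.Nat as ℕ using (ℕ; zero; suc)
  open import Data.Fin using (Fin; zero; suc)
  open import Data.Integer as ℤ using (+_)
  import Data.Integer.Properties as ℤ
  import Data.Nat.Properties as ℕ
  open import Data.Rational using (ℚ; 0ℚ; _+_; _-_; _*_; _≤_; _/_; toℚᵘ)
  open import Data.Rational.Properties
  import Data.Rational.Unnormalised as ℚᵘ
  import Data.Rational.Unnormalised.Properties as ℚᵘ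
  open import Data.Rational.Solver using (module +-*-Solver)
  open import Data.Vec.Functional using (Vector)
  open import Data.List as List using (_++_)
  import Data.List.Relation.Unary.All.Properties as All
  open import Data.Product using (_,_)
  open import Function using (_⇔_; mk⇔; Equivalence)
  open import Function.Properties.Equivalence using () renaming (trans to ⇔-trans)
  open import Relation.Binary.PropositionalEquality
  open import Defs
  open FourierMotzkin

  open +-*-Solver using (solve; _:+_; _:-_; _:*_; _:=_; con)
  open Equivalence using (to; from)

  capacity : ∀ {m} → Fin m → Fin m → ℚ
  capacity i j = (+ 2) / (idx i ℕ.* idx j)

  capacityRow : ∀ {m} → Fin m → Fin m → Affine m
  capacityRow i j = constantAffine (capacity i j) ⊖ coordinate i ⊖ coordinate j

  constraints : ∀ m → System m
  constraints m =
    List.tabulate coordinate ++ List.concat (List.tabulate λ i → List.tabulate (capacityRow i))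

  ⊨-capacityRow⇔ : ∀ {m} i j (x : Vector ℚ m) → x ⊨ capacityRow i j ⇔ x i + x j ≤ capacity i j
  ⊨-capacityRow⇔ i j x = ⇔-trans (≡⇒⇔ (cong (0ℚ ≤_) value)) 0≤q-p⇔p≤q
    where
      c = capacity i j
      value : ⟦ capacityRow i j ⟧ x ≡ c - (x i + x j)
      value = begin
        ⟦ constantAffine c ⊖ coordinate i ⊖ coordinate j ⟧ x
          ≡⟨ ⟦⊖⟧ (constantAffine c ⊖ coordinate i) (coordinate j) x ⟩
        ⟦ constantAffine c ⊖ coordinate i ⟧ x - ⟦ coordinate j ⟧ x
          ≡⟨ cong (_- ⟦ coordinate j ⟧ x) (⟦⊖⟧ (constantAffine c) (coordinate i) x) ⟩
        ⟦ constantAffine c ⟧ x - ⟦ coordinate i ⟧ x - ⟦ coordinate j ⟧ x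
          ≡⟨ cong₂ (λ u v → u - v - ⟦ coordinate j ⟧ x) (⟦constantAffine⟧ c x) (⟦coordinate⟧ i x) ⟩
        c - x i - ⟦ coordinate j ⟧ x
          ≡⟨ cong (c - x i -_) (⟦coordinate⟧ j x) ⟩
        c - x i - x j
          ≡⟨ solve 3 (λ c a b → c :- a :- b := c :- (a :+ b)) refl c (x i) (x j) ⟩
        c - (x i + x j)
          ∎
        where open ≡-Reasoning

  ⊨-coordinate⇔ : ∀ {m} i (x : Vector ℚ m) → x ⊨ coordinate i ⇔ 0ℚ ≤ x i
  ⊨-coordinate⇔ i x = ≡⇒⇔ (cong (0ℚ ≤_) (⟦coordinate⟧ i x))

  feasible⇔ : ∀ {m} {x : Vector ℚ m} → Feasible m x ⇔ x ⊨* constraints m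
  feasible⇔ {m} {x} = mk⇔
    (λ (nonneg , capped) → All.++⁺
      (All.tabulate⁺ λ i → from (⊨-coordinate⇔ i x) (nonneg i))
      (All.concat⁺ (All.tabulate⁺ λ i → All.tabulate⁺ λ j →
        from (⊨-capacityRow⇔ i j x) (capped i j))))
    (λ h → let nonneg , capped = All.++⁻ (List.tabulate coordinate) h in
        (λ i → to (⊨-coordinate⇔ i x) (All.tabulate⁻ nonneg i))
      , (λ i j → to (⊨-capacityRow⇔ i j x)
                    (All.tabulate⁻ (All.tabulate⁻ (All.concat⁻ capped) i) j)))

  /-split : ∀ a d .{{_ : ℕ.NonZero d}} → (+ a) / d ≡ (+ a) / 1 * ((+ 1) / d)
  /-split a d@(suc e) = toℚᵘ-injective (begin
    toℚᵘ ((+ a) / d)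
      ≈⟨ toℚᵘ-fromℚᵘ ((+ a) ℚᵘ./ d) ⟩
    (+ a) ℚᵘ./ d
      ≈⟨ ℚᵘ.*≡* (cong₂ ℤ._*_ (sym (ℤ.*-identityʳ (+ a))) (cong (λ k → + suc k) (ℕ.+-identityʳ e))) ⟩
    (+ a) ℚᵘ./ 1 ℚᵘ.* ((+ 1) ℚᵘ./ d)
      ≈⟨ ℚᵘ.≃-sym (ℚᵘ.*-cong (toℚᵘ-fromℚᵘ ((+ a) ℚᵘ./ 1)) (toℚᵘ-fromℚᵘ ((+ 1) ℚᵘ./ d))) ⟩
    toℚᵘ ((+ a) / 1) ℚᵘ.* toℚᵘ ((+ 1) / d)
      ≈⟨ ℚᵘ.≃-sym (toℚᵘ-homo-* ((+ a) / 1) ((+ 1) / d)) ⟩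
    toℚᵘ ((+ a) / 1 * ((+ 1) / d))
      ∎)
    where open ℚᵘ.≃-Reasoning

  half-≤ : ∀ d .{{_ : ℕ.NonZero d}} {x} → x + x ≤ (+ 2) / d → x ≤ (+ 1) / d
  half-≤ d {x} h = *-cancelˡ-≤-pos ((+ 2) / 1) (subst₂ _≤_ (sym twice) (/-split 2 d) h)
    where
      twice : (+ 2) / 1 * x ≡ x + x
      twice = solve 1 (λ x → con ((+ 2) / 1) :* x := x :+ x) refl x

  weighted-≤ : ∀ a d .{{_ : ℕ.NonZero d}} {x} → x + x ≤ (+ 2) / d → (+ a) / 1 * x ≤ (+ a) / d
  weighted-≤ a d h = subst ((+ a) / 1 * _ ≤_) (sym (/-split a d))
    (*-monoˡ-≤-nonNeg ((+ a) / 1) {{normalize-nonNeg a 1}} (half-≤ d h))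

  sumFin-mono-≤ : ∀ {m} {f g : Vector ℚ m} → (∀ i → f i ≤ g i) → sumFin f ≤ sumFin g
  sumFin-mono-≤ {zero}  f≤g = ≤-refl
  sumFin-mono-≤ {suc m} f≤g = +-mono-≤ (f≤g zero) (sumFin-mono-≤ (λ i → f≤g (suc i)))

  objective≤bound : ∀ {m x} → Feasible m x → objective m x ≤ bound m
  objective≤bound (_ , capped) = sumFin-mono-≤ λ i → weighted-≤ (totient (idx i)) _ (capped i i)

  zero-feasible : ∀ m → Feasible m (λ _ → 0ℚ)
  zero-feasible m =
    (λ _ → ≤-refl) , λ i j → nonNegative⁻¹ (capacity i j) {{normalize-nonNeg 2 (idx i ℕ.* idx j)}}

  optimum : ∀ m → Maximiser (objective m) (constraints m)
  optimum m = maximise (λ i → (+ totient (idx i)) / 1) (constraints m) (λ _ → 0ℚ)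
    (to feasible⇔ (zero-feasible m)) (bound m) (λ x h → objective≤bound (from feasible⇔ h))

open import Defs
open import Data.Nat using (ℕ; _≤_)
open import Data.Fin using (Fin)
open import Data.Rational using (ℚ)
open import Data.Product using (Σ; _×_)
import Data.Rational as Q

open import Data.Product using (_,_)
open import Function using (Equivalence)
open Equivalence using (to; from)
open TotientProgram using (optimum; feasible⇔; objective≤bound)

lemma3p5 : (m : ℕ) → 1 ≤ m →
    Σ (Fin m → ℚ) (λ xopt →
      Feasible m xopt
      × ((x : Fin m → ℚ) → Feasible m x → objective m x Q.≤ objective m xopt)
      × objective m xopt Q.≤ bound m)
lemma3p5 m _ =
  let xopt , h , maximal = optimum m
      feasible = from feasible⇔ h
  in xopt , feasible , (λ x hx → maximal x (to feasible⇔ hx)) , objective≤bound feasible
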